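{- Let $D(n,k)$ be the recursion depth defined in the context. Let $n\ge 0$ and $k\ge 1$ be integers. If $k\in\{1,2\}$, or if $k\ge 4$ is even and $n\ge 2$, or if $k\ge 5$ is odd and $n\ge 4$, then $$D(n,k)=\left\lceil \frac{\lfloor k/2\rfloor\, n}{2}\right\rceil-\left\lceil\frac{k}{2}\right\rceil+1 .$$ For $k=3$, $D(n,3)=\lceil n/4\rceil$.
   Context: For a partition $\lambda$ of a positive integer $k$ and $1\le i\le k$, let $d_i=d_i(\lambda)$ be the number of parts of $\lambda$ equal to $i$. For integers $n$ and $0\le i\le k-1$ put $$n'_\lambda(i)=(k-i)n-2i+2\sum_{j=0}^{i-1}(i-j)\,d_{k-j}.$$ This is the first argument of the recursive calls in Zeilberger's recurrence for $q$-binomial coefficients $$G(n,k)=\sum_{\lambda\vdash k} q^{k|\lambda|-k-\sum_{1\le j<i\le k}(i-j)d_id_j}\prod_{i=0}^{k-1}G\big(n'_\lambda(i),d_{k-i}(\lambda)\big),$$ where $|\lambda|=\sum_i d_i$. This recurrence is used for $n\ge1,k\ge2$. The initial conditions are: $G(n,k)=0$ if $n<0$ or $k<0$; $G(0,k)=G(n,0)=1$; and $G(n,1)=(1-q^{n+1})/(1-q)$. The recursion depth $D(n,k)$ is defined for all integers $n,k$ as follows. Set $D(n,k)=0$ if $(n,k)$ falls under an initial condition, that is, if $n\le 0$, or $k\le 0$, or $k=1$. Otherwise, when $n\ge1$ and $k\ge2$, set $$D(n,k)=1+\max\{D(n'_\lambda(i),d_{k-i}(\lambda)) : \lambda\vdash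 k,\ 0\le i\le k-1\}.$$ -}

module Defs where

open import Data.Nat as ℕ using (ℕ; zero; suc; _∸_; _≤ᵇ_)
open import Data.Bool using (Bool; true; false; if_then_else_; _∨_)
open import Data.List using (List; []; _∷_; map; concatMap; foldr; length; upTo; filterᵇ)
open import Data.Integer as ℤ using (ℤ; +_; -[1+_])
open import Data.Product using (∃-syntax)
open import Relation.Binary.PropositionalEquality using (_≡_)

range : ℕ → ℕ → List ℕ
range a b = map (a ℕ.+_) (upTo (suc b ∸ a))

-- Partitions of r into positive parts, each ≤ m, as non-increasing lists of parts.
-- The first argument is fuel; it is called with fuel = r, which suffices since
-- every step removes a part ≥ 1.
partsGo : ℕ → ℕ → ℕ → List (List ℕ)
partsGo _        _ zero = [] ∷ []
partsGo zero     _ (suc r) = []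
partsGo (suc fu) m (suc r) =
  concatMap (λ p → map (p ∷_) (partsGo fu p (suc r ∸ p))) (range 1 (m ℕ.⊓ suc r))

partitions : ℕ → List (List ℕ)
partitions k = partsGo k k k

mult : ℕ → List ℕ → ℕ
mult i λs = length (filterᵇ (λ p → p ℕ.≡ᵇ i) λs)

nPrime : ℤ → ℕ → List ℕ → ℕ → ℤ
nPrime n k λs i =
  ((+ (k ∸ i)) ℤ.* n ℤ.- (+ (2 ℕ.* i)))
    ℤ.+ (+ (2 ℕ.* foldr ℕ._+_ 0 (map (λ j → (i ∸ j) ℕ.* mult (k ∸ j) λs) (range 0 (i ∸ 1)))))

maxList : List ℕ → ℕ
maxList = foldr ℕ._⊔_ 0

-- D(n,k) = 0 iff (n,k) is an initial condition: n ≤ 0, or k ≤ 0, or k = 1.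
-- (k ranges over ℕ: all second arguments d_{k-i}(λ) are counts, hence ≥ 0.)
isInitial : ℤ → ℕ → Bool
isInitial n k = (n ℤ.≤ᵇ + 0) ∨ (k ≤ᵇ 1)

-- Fuel-truncated recursion depth: with fuel f this computes
--   min-truncation of D(n,k); it agrees with D(n,k) as soon as f > D(n,k).
Dfuel : ℕ → ℤ → ℕ → ℕ
Dfuel zero     n k = 0
Dfuel (suc f) n k =
  if isInitial n k then 0
  else suc (maxList (concatMap (λ λs → map (λ i → Dfuel f (nPrime n k λs i) (mult (k ∸ i) λs))
                                            (range 0 (k ∸ 1)))
                               (partitions k)))

-- Since the recursion terminates, Dfuel f n k = D(n,k) for every f > D(n,k), so this
-- says exactly D(n,k) = v.
DepthIs : ℤ → ℕ → ℤ → Set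
DepthIs n k v = ∃[ F ] (∀ f → F ℕ.≤ f → + (Dfuel f n k) ≡ v)

-- Upper bound: let B(n, k) be the claimed depth, ⌈n/4⌉ for k = 3 and max(1, ⌈⌊k/2⌋ n/2⌉ - ⌈k/2⌉ + 1) otherwise.
-- A recursive call with part size m = k - i and d = d_m(λ) has n′ = m n - 2i + 2T, where
-- T = Σ_{p ∈ λ} (p - m)⁺ and T + m d ≤ k; with slack = k - (T + m d) this reads
-- m (n - 2(d - 1)) = n′ + 2 slack, which forces B(n′, d) < B(n, k).  Hence D ≤ B by induction.
-- Lower bound: the partition 1^k with i = k - 1 sends (n, k) to (n - 2(k - 1), k), giving
-- D(n, 2) ≥ ⌈n/2⌉ and D(n, 3) ≥ ⌈n/4⌉; for k ≥ 4 the partition (⌊k/2⌋, ⌊k/2⌋[, 1]) with i = ⌈k/2⌉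
-- sends (n, k) to (⌊k/2⌋ n - 2⌈k/2⌉, 2), which matches B(n, k) whenever that argument is ≥ 0.

module Submission where

open import Defs
open import Data.Bool using (Bool; true; false; if_then_else_)
open import Data.Empty using (⊥-elim)
open import Data.Integer as ℤ using (ℤ; +_; -[1+_]; _⊖_; _-_) renaming (_+_ to _+ℤ_)
open import Data.Integer.Properties using (m-n≡m⊖n; ⊖-≥; pos-+; pos-*; +-injective)
import Data.Integer.Tactic.RingSolver as ℤ-Solver
open import Data.List using (List; []; _∷_; map; concatMap; upTo; replicate; _++_; [_])
open import Data.List.Properties using (map-++; map-∘; upTo-∷ʳ)
open import Data.List.Membership.Propositional using (_∈_; find; lose)
open import Data.List.Membership.Propositional.Properties
  using (∈-map⁺; ∈-map⁻; ∈-concatMap⁺; ∈-concatMap⁻; ∈-upTo⁺; ∈-upTo⁻)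
open import Data.List.Relation.Unary.All as All using (All; []; _∷_)
open import Data.List.Relation.Unary.Any using (here; there)
open import Data.Nat using (ℕ; zero; suc; _+_; _*_; _∸_; _≤_; _<_; _⊔_; _⊓_; z≤n; s≤s; z<s; ⌊_/2⌋; ⌈_/2⌉; _/_; _≡ᵇ_)
open import Data.Nat.Divisibility using (_∣_; divides; ∣1⇒≡1; ∣m+n∣m⇒∣n)
open import Data.Nat.DivMod using (m/n*n≤m; m/n≡1+[m∸n]/n)
open import Data.Nat.ListAction using (sum)
open import Data.Nat.ListAction.Properties using (sum-++)
open import Data.Nat.Properties
open import Data.Nat.Tactic.RingSolver using (solve-∀)
open import Data.Product using (∃-syntax; _×_; _,_; proj₂)
open import Data.Sum using (_⊎_; inj₁; inj₂)
open import Data.Unit using (tt)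
open import Function using (_∘_)
open import Relation.Nullary using (¬_; Dec; yes; no)
open import Relation.Binary.PropositionalEquality hiding ([_])

∈-range⁺ : ∀ {a b x} → a ≤ x → x ≤ b → x ∈ range a b
∈-range⁺ {a} {b} a≤x x≤b =
  subst (_∈ range a b) (m+[n∸m]≡n a≤x) (∈-map⁺ (_+_ a) (∈-upTo⁺ (∸-monoˡ-< (s≤s x≤b) a≤x)))

∈-range⁻ : ∀ {a b x} → x ∈ range a b → a ≤ x × x ≤ b
∈-range⁻ {a} {b} x∈ with y , y∈ , refl ← ∈-map⁻ (_+_ a) x∈ =
  m≤m+n a y , ≤-pred (subst (_≤ suc b) (cong suc (+-comm y a)) (m≤o∸n⇒m+n≤o (suc y) a≤1+b y<))
  where
  y< : y < suc b ∸ a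
  y< = ∈-upTo⁻ y∈
  a≤1+b : a ≤ suc b
  a≤1+b = <⇒≤ (m∸n≢0⇒n<m (λ eq → n≮0 (subst (y <_) eq y<)))

≤-maxList : ∀ {x xs} → x ∈ xs → x ≤ maxList xs
≤-maxList {xs = y ∷ ys} (here refl) = m≤m⊔n y (maxList ys)
≤-maxList {xs = y ∷ ys} (there x∈) = ≤-trans (≤-maxList x∈) (m≤n⊔m y (maxList ys))

maxList< : ∀ {b} xs → 0 < b → (∀ {x} → x ∈ xs → x < b) → maxList xs < b
maxList< []       0<b _    = 0<b
maxList< (x ∷ xs) 0<b all< = ⊔-lub (all< (here refl)) (maxList< xs 0<b (all< ∘ there))

⌈m+2n/2⌉≡⌈m/2⌉+n : ∀ m n → ⌈ m + 2 * n /2⌉ ≡ ⌈ m /2⌉ + n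
⌈m+2n/2⌉≡⌈m/2⌉+n m zero    = trans (cong ⌈_/2⌉ (+-identityʳ m)) (sym (+-identityʳ _))
⌈m+2n/2⌉≡⌈m/2⌉+n m (suc n) =
  trans (cong ⌈_/2⌉ (shift m n)) (trans (cong suc (⌈m+2n/2⌉≡⌈m/2⌉+n m n)) (sym (+-suc _ n)))
  where
  shift : ∀ m n → m + 2 * suc n ≡ suc (suc (m + 2 * n))
  shift = solve-∀

⌈m/2⌉≡⌈[m∸2n]/2⌉+n : ∀ {m n} → 2 * n ≤ m → ⌈ m /2⌉ ≡ ⌈ m ∸ 2 * n /2⌉ + n
⌈m/2⌉≡⌈[m∸2n]/2⌉+n {m} {n} 2n≤m = trans (cong ⌈_/2⌉ (sym (m∸n+n≡m 2n≤m))) (⌈m+2n/2⌉≡⌈m/2⌉+n (m ∸ 2 * n) n)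

m+2n≤o⇒⌈m/2⌉+n≤⌈o/2⌉ : ∀ {m n o} → m + 2 * n ≤ o → ⌈ m /2⌉ + n ≤ ⌈ o /2⌉
m+2n≤o⇒⌈m/2⌉+n≤⌈o/2⌉ {m} {n} le = subst (_≤ _) (⌈m+2n/2⌉≡⌈m/2⌉+n m n) (⌈n/2⌉-mono le)

2m≤n⇒m≤⌈n/2⌉ : ∀ {m n} → 2 * m ≤ n → m ≤ ⌈ n /2⌉
2m≤n⇒m≤⌈n/2⌉ {m} = m+2n≤o⇒⌈m/2⌉+n≤⌈o/2⌉ {0} {m}

2m≤n⇒m≤⌊n/2⌋ : ∀ {m n} → 2 * m ≤ n → m ≤ ⌊ n /2⌋
2m≤n⇒m≤⌊n/2⌋ {m} {n} le =
  subst (_≤ ⌊ n /2⌋) (sym (n≡⌊n+n/2⌋ m)) (⌊n/2⌋-mono (subst (_≤ n) (cong (_+_ m) (+-identityʳ m)) le))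

⌈n/2⌉≤1+⌊n/2⌋ : ∀ n → ⌈ n /2⌉ ≤ suc ⌊ n /2⌋
⌈n/2⌉≤1+⌊n/2⌋ zero          = z≤n
⌈n/2⌉≤1+⌊n/2⌋ (suc zero)    = ≤-refl
⌈n/2⌉≤1+⌊n/2⌋ (suc (suc n)) = s≤s (⌈n/2⌉≤1+⌊n/2⌋ n)

2⌊n/2⌋≤n : ∀ n → 2 * ⌊ n /2⌋ ≤ n
2⌊n/2⌋≤n n = begin
  2 * ⌊ n /2⌋          ≡⟨ cong (_+_ ⌊ n /2⌋) (+-identityʳ ⌊ n /2⌋) ⟩
  ⌊ n /2⌋ + ⌊ n /2⌋    ≤⟨ +-monoʳ-≤ ⌊ n /2⌋ (⌊n/2⌋≤⌈n/2⌉ n) ⟩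
  ⌊ n /2⌋ + ⌈ n /2⌉    ≡⟨ ⌊n/2⌋+⌈n/2⌉≡n n ⟩
  n                    ∎
  where open ≤-Reasoning

⌈n/2⌉≡⌊n/2⌋⊎⌈n/2⌉≡1+⌊n/2⌋ : ∀ n → ⌈ n /2⌉ ≡ ⌊ n /2⌋ ⊎ ⌈ n /2⌉ ≡ suc ⌊ n /2⌋
⌈n/2⌉≡⌊n/2⌋⊎⌈n/2⌉≡1+⌊n/2⌋ zero          = inj₁ refl
⌈n/2⌉≡⌊n/2⌋⊎⌈n/2⌉≡1+⌊n/2⌋ (suc zero)    = inj₂ refl
⌈n/2⌉≡⌊n/2⌋⊎⌈n/2⌉≡1+⌊n/2⌋ (suc (suc n)) with ⌈n/2⌉≡⌊n/2⌋⊎⌈n/2⌉≡1+⌊n/2⌋ n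
... | inj₁ eq = inj₁ (cong suc eq)
... | inj₂ eq = inj₂ (cong suc eq)

even⇒⌈n/2⌉≡⌊n/2⌋ : ∀ {n} → 2 ∣ n → ⌈ n /2⌉ ≡ ⌊ n /2⌋
even⇒⌈n/2⌉≡⌊n/2⌋ {n} 2∣n with ⌈n/2⌉≡⌊n/2⌋⊎⌈n/2⌉≡1+⌊n/2⌋ n
... | inj₁ c≡h   = c≡h
... | inj₂ c≡1+h = ⊥-elim (<-irrefl (sym (∣1⇒≡1 (∣m+n∣m⇒∣n 2∣2h+1 (divides ⌊ n /2⌋ (*-comm 2 ⌊ n /2⌋))))) (n<1+n 1))
  where
  2∣2h+1 : 2 ∣ 2 * ⌊ n /2⌋ + 1
  2∣2h+1 = subst (2 ∣_) (trans (sym (⌊n/2⌋+⌈n/2⌉≡n n)) (trans (cong (_+_ ⌊ n /2⌋) c≡1+h) (regroup ⌊ n /2⌋))) 2∣n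
    where
    regroup : ∀ h → h + suc h ≡ 2 * h + 1
    regroup = solve-∀

odd⇒⌈n/2⌉≡1+⌊n/2⌋ : ∀ {n} → ¬ 2 ∣ n → ⌈ n /2⌉ ≡ suc ⌊ n /2⌋
odd⇒⌈n/2⌉≡1+⌊n/2⌋ {n} 2∤n with ⌈n/2⌉≡⌊n/2⌋⊎⌈n/2⌉≡1+⌊n/2⌋ n
... | inj₂ c≡1+h = c≡1+h
... | inj₁ c≡h   = ⊥-elim (2∤n (divides ⌊ n /2⌋ (trans (sym (⌊n/2⌋+⌈n/2⌉≡n n)) (trans (cong (_+_ ⌊ n /2⌋) c≡h) (regroup ⌊ n /2⌋)))))
  where
  regroup : ∀ h → h + h ≡ h * 2
  regroup = solve-∀

[4+n]/4≡1+n/4 : ∀ n → (4 + n) / 4 ≡ suc (n / 4)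
[4+n]/4≡1+n/4 n = m/n≡1+[m∸n]/n (m≤m+n 4 n)

2[n+3]/4≤n+1 : ∀ {n} → 1 ≤ n → 2 * ((n + 3) / 4) ≤ n + 1
2[n+3]/4≤n+1 {n} 1≤n = *-cancelˡ-≤ 2 (begin
  2 * (2 * ((n + 3) / 4))   ≡⟨ *-comm-4 ((n + 3) / 4) ⟩
  (n + 3) / 4 * 4           ≤⟨ m/n*n≤m (n + 3) 4 ⟩
  n + 3                     ≤⟨ +-monoʳ-≤ n (+-monoˡ-≤ 2 1≤n) ⟩
  n + (n + 2)               ≡⟨ regroup n ⟩
  2 * (n + 1)               ∎)
  where
  open ≤-Reasoning
  *-comm-4 : ∀ q → 2 * (2 * q) ≡ q * 4
  *-comm-4 = solve-∀
  regroup : ∀ n → n + (n + 2) ≡ 2 * (n + 1)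
  regroup = solve-∀

-- Partitions and multiplicities

record IsPartition (r m : ℕ) (xs : List ℕ) : Set where
  field
    sum≡ : sum xs ≡ r
    parts≥1 : All (1 ≤_) xs
    parts≤ : All (_≤ m) xs

open IsPartition

partsGo-sound : ∀ fuel m r {xs} → xs ∈ partsGo fuel m r → IsPartition r m xs
partsGo-sound _          m zero    (here refl) = record { sum≡ = refl ; parts≥1 = [] ; parts≤ = [] }
partsGo-sound zero       m (suc r) ()
partsGo-sound (suc fuel) m (suc r) xs∈
  with p , p∈ , xs∈′ ← find (∈-concatMap⁻ _ {xs = range 1 (m ⊓ suc r)} xs∈)
  with ys , ys∈ , refl ← ∈-map⁻ (p ∷_) xs∈′
  with 1≤p , p≤m⊓1+r ← ∈-range⁻ p∈ = record
  { sum≡ = trans (cong (_+_ p) (sum≡ ys-part)) (m+[n∸m]≡n (≤-trans p≤m⊓1+r (m⊓n≤n m (suc r))))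
  ; parts≥1 = 1≤p ∷ parts≥1 ys-part
  ; parts≤ = p≤m ∷ All.map (λ q≤p → ≤-trans q≤p p≤m) (parts≤ ys-part)
  }
  where
  ys-part : IsPartition (suc r ∸ p) p ys
  ys-part = partsGo-sound fuel p (suc r ∸ p) ys∈
  p≤m : p ≤ m
  p≤m = ≤-trans p≤m⊓1+r (m⊓n≤m m (suc r))

partitions-sound : ∀ {k xs} → xs ∈ partitions k → IsPartition k k xs
partitions-sound {k} = partsGo-sound k k k

∷-∈-partsGo : ∀ {fuel m r p ys} → 1 ≤ p → p ≤ m → p ≤ r →
              ys ∈ partsGo fuel p (r ∸ p) → p ∷ ys ∈ partsGo (suc fuel) m r
∷-∈-partsGo {r = zero}  (s≤s _) _ () _
∷-∈-partsGo {m = m} {suc r} {p} 1≤p p≤m p≤r ys∈ =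
  ∈-concatMap⁺ _ {xs = range 1 (m ⊓ suc r)} (lose (∈-range⁺ 1≤p (⊓-glb p≤m p≤r)) (∈-map⁺ (p ∷_) ys∈))

replicate-∈-partsGo : ∀ r {m} → 1 ≤ m → replicate r 1 ∈ partsGo r m r
replicate-∈-partsGo zero    _   = here refl
replicate-∈-partsGo (suc r) 1≤m = ∷-∈-partsGo ≤-refl 1≤m (s≤s z≤n) (replicate-∈-partsGo r ≤-refl)

halves-∈-partitions : ∀ {k₀ h rest} → 1 ≤ h → h + h + sum rest ≡ 2 + k₀ →
                      rest ∈ partsGo k₀ h (sum rest) → h ∷ h ∷ rest ∈ partitions (2 + k₀)
halves-∈-partitions {k₀} {h} {rest} 1≤h k≡ rest∈ =
  subst (λ k → h ∷ h ∷ rest ∈ partsGo (2 + k₀) k k) k≡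
    (∷-∈-partsGo 1≤h h≤k h≤k (subst (λ r → h ∷ rest ∈ partsGo (suc k₀) h r) (sym k∸h≡h+s)
      (∷-∈-partsGo 1≤h ≤-refl (m≤m+n h s) (subst (λ r → rest ∈ partsGo k₀ h r) (sym (m+n∸m≡n h s)) rest∈))))
  where
  s : ℕ
  s = sum rest
  h≤k : h ≤ h + h + s
  h≤k = ≤-trans (m≤m+n h h) (m≤m+n (h + h) s)
  k∸h≡h+s : h + h + s ∸ h ≡ h + s
  k∸h≡h+s = trans (cong (_∸ h) (+-assoc h h s)) (m+n∸m≡n h (h + s))

indicator : Bool → ℕ
indicator b = if b then 1 else 0

indicator-≡ : ∀ {p x} → p ≡ x → indicator (p ≡ᵇ x) ≡ 1
indicator-≡ {p} {x} p≡x with p ≡ᵇ x | ≡⇒≡ᵇ p x p≡x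
... | true | _ = refl

indicator-≢ : ∀ {p x} → p ≢ x → indicator (p ≡ᵇ x) ≡ 0
indicator-≢ {p} {x} p≢x with p ≡ᵇ x | ≡ᵇ⇒≡ p x
... | false | _     = refl
... | true  | sound = ⊥-elim (p≢x (sound tt))

mult-∷ : ∀ x p xs → mult x (p ∷ xs) ≡ indicator (p ≡ᵇ x) + mult x xs
mult-∷ x p xs with p ≡ᵇ x
... | true  = refl
... | false = refl

mult-self-∷ : ∀ p xs → mult p (p ∷ xs) ≡ suc (mult p xs)
mult-self-∷ p xs = trans (mult-∷ p p xs) (cong (_+ mult p xs) (indicator-≡ {p} refl))

mult-other-∷ : ∀ {p x} xs → p ≢ x → mult x (p ∷ xs) ≡ mult x xs
mult-other-∷ {p} {x} xs p≢x = trans (mult-∷ x p xs) (cong (_+ mult x xs) (indicator-≢ p≢x))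

mult-replicate : ∀ r → mult 1 (replicate r 1) ≡ r
mult-replicate zero    = refl
mult-replicate (suc r) = cong suc (mult-replicate r)

excess : ℕ → List ℕ → ℕ
excess m xs = sum (map (_∸ m) xs)

excess-replicate : ∀ r → excess 1 (replicate r 1) ≡ 0
excess-replicate zero    = refl
excess-replicate (suc r) = excess-replicate r

excess+m*mult-∷ : ∀ m p xs → excess m (p ∷ xs) + m * mult m (p ∷ xs)
                  ≡ ((p ∸ m) + m * indicator (p ≡ᵇ m)) + (excess m xs + m * mult m xs)
excess+m*mult-∷ m p xs =
  trans (cong (λ c → (p ∸ m) + excess m xs + m * c) (mult-∷ m p xs))
        (regroup (p ∸ m) (indicator (p ≡ᵇ m)) (excess m xs) (mult m xs) m)
  where
  regroup : ∀ a b c d m → a + c + m * (b + d) ≡ (a + m * b) + (c + m * d)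
  regroup = solve-∀

p∸m+m*[p≡m]≤p : ∀ m p → (p ∸ m) + m * indicator (p ≡ᵇ m) ≤ p
p∸m+m*[p≡m]≤p m p with p ≟ m
... | yes refl rewrite n∸n≡0 p | indicator-≡ {p} refl = ≤-reflexive (*-identityʳ p)
... | no p≢m rewrite indicator-≢ p≢m | *-zeroʳ m | +-identityʳ (p ∸ m) = m∸n≤m p m

excess+m*mult≤sum : ∀ m xs → excess m xs + m * mult m xs ≤ sum xs
excess+m*mult≤sum m []       = ≤-reflexive (*-zeroʳ m)
excess+m*mult≤sum m (p ∷ xs) = begin
  excess m (p ∷ xs) + m * mult m (p ∷ xs)                          ≡⟨ excess+m*mult-∷ m p xs ⟩
  (p ∸ m) + m * indicator (p ≡ᵇ m) + (excess m xs + m * mult m xs) ≤⟨ +-mono-≤ (p∸m+m*[p≡m]≤p m p) (excess+m*mult≤sum m xs) ⟩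
  p + sum xs                                                       ∎
  where open ≤-Reasoning

excess>0⇒excess+m*mult+m≤sum : ∀ m xs → 0 < excess m xs → excess m xs + m * mult m xs + m ≤ sum xs
excess>0⇒excess+m*mult+m≤sum m (p ∷ xs) 0<excess with m <? p
... | yes m<p = begin
  excess m (p ∷ xs) + m * mult m (p ∷ xs) + m ≡⟨ cong (_+ m) (excess+m*mult-∷ m p xs) ⟩
  a + rest + m                                ≡⟨ +-assoc a rest m ⟩
  a + (rest + m)                              ≡⟨ cong (_+_ a) (+-comm rest m) ⟩
  a + (m + rest)                              ≡⟨ +-assoc a m rest ⟨
  a + m + rest                                ≤⟨ +-mono-≤ part+m≤p (excess+m*mult≤sum m xs) ⟩
  p + sum xs                                  ∎
  where
  open ≤-Reasoning
  a rest : ℕ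
  a = (p ∸ m) + m * indicator (p ≡ᵇ m)
  rest = excess m xs + m * mult m xs
  part+m≤p : a + m ≤ p
  part+m≤p rewrite indicator-≢ {p} {m} (λ p≡m → <-irrefl (sym p≡m) m<p) | *-zeroʳ m | +-identityʳ (p ∸ m) =
    ≤-reflexive (m∸n+n≡m (<⇒≤ m<p))
... | no m≮p = begin
  excess m (p ∷ xs) + m * mult m (p ∷ xs) + m ≡⟨ cong (_+ m) (excess+m*mult-∷ m p xs) ⟩
  a + rest + m                                ≡⟨ +-assoc a rest m ⟩
  a + (rest + m)                              ≤⟨ +-mono-≤ (p∸m+m*[p≡m]≤p m p) (excess>0⇒excess+m*mult+m≤sum m xs 0<rest) ⟩
  p + sum xs                                  ∎
  where
  open ≤-Reasoning
  a rest : ℕ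
  a = (p ∸ m) + m * indicator (p ≡ᵇ m)
  rest = excess m xs + m * mult m xs
  0<rest : 0 < excess m xs
  0<rest = subst (λ e → 0 < e + excess m xs) (m≤n⇒m∸n≡0 (≮⇒≥ m≮p)) 0<excess

sum≤mult₁+2*excess₁ : ∀ {xs} → All (1 ≤_) xs → sum xs ≤ mult 1 xs + 2 * excess 1 xs
sum≤mult₁+2*excess₁ []                  = z≤n
sum≤mult₁+2*excess₁ {p ∷ xs} (1≤p ∷ ps) = begin
  p + sum xs                                                              ≤⟨ +-mono-≤ (part-bound 1≤p) (sum≤mult₁+2*excess₁ ps) ⟩
  indicator (p ≡ᵇ 1) + 2 * (p ∸ 1) + (mult 1 xs + 2 * excess 1 xs)         ≡⟨ regroup (indicator (p ≡ᵇ 1)) (mult 1 xs) (p ∸ 1) (excess 1 xs) ⟩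
  indicator (p ≡ᵇ 1) + mult 1 xs + 2 * excess 1 (p ∷ xs)                   ≡⟨ cong (_+ 2 * excess 1 (p ∷ xs)) (mult-∷ 1 p xs) ⟨
  mult 1 (p ∷ xs) + 2 * excess 1 (p ∷ xs)                                  ∎
  where
  open ≤-Reasoning
  part-bound : ∀ {p} → 1 ≤ p → p ≤ indicator (p ≡ᵇ 1) + 2 * (p ∸ 1)
  part-bound {suc zero}    _ = ≤-refl
  part-bound {suc (suc q)} _ = s≤s (≤-trans (m≤n+m (suc q) q) (≤-reflexive (cong (λ z → q + suc z) (sym (+-identityʳ q)))))
  regroup : ∀ a b c d → a + 2 * c + (b + 2 * d) ≡ a + b + 2 * (c + d)
  regroup = solve-∀

halving-partition : ∀ {k} → 4 ≤ k → ∃[ λs ] (λs ∈ partitions k × mult ⌊ k /2⌋ λs ≡ 2 × excess ⌊ k /2⌋ λs ≡ 0)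
halving-partition {k@(suc (suc (suc (suc k₁))))} 4≤k@(s≤s (s≤s (s≤s (s≤s _)))) with ⌈n/2⌉≡⌊n/2⌋⊎⌈n/2⌉≡1+⌊n/2⌋ k
... | inj₁ c≡h =
  h ∷ h ∷ [] ,
  halves-∈-partitions {rest = []} (≤-trans (s≤s z≤n) 2≤h) (trans (+-identityʳ (h + h)) h+h≡k) (here refl) ,
  trans (mult-self-∷ h (h ∷ [])) (cong suc (mult-self-∷ h [])) ,
  cong₂ _+_ (n∸n≡0 h) (cong (_+ 0) (n∸n≡0 h))
  where
  h : ℕ
  h = ⌊ k /2⌋
  2≤h : 2 ≤ h
  2≤h = 2m≤n⇒m≤⌊n/2⌋ {2} 4≤k
  h+h≡k : h + h ≡ k
  h+h≡k = trans (cong (_+_ h) (sym c≡h)) (⌊n/2⌋+⌈n/2⌉≡n k)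
... | inj₂ c≡1+h =
  h ∷ h ∷ 1 ∷ [] ,
  halves-∈-partitions {rest = 1 ∷ []} (≤-trans (s≤s z≤n) 2≤h) (trans (regroup h) h+1+h≡k) (∷-∈-partsGo {k₁} ≤-refl (≤-trans (s≤s z≤n) 2≤h) ≤-refl (here refl)) ,
  trans (mult-self-∷ h (h ∷ 1 ∷ [])) (cong suc (trans (mult-self-∷ h (1 ∷ [])) (cong suc (mult-other-∷ [] 1≢h)))) ,
  cong₂ _+_ (n∸n≡0 h) (cong₂ _+_ (n∸n≡0 h) (cong (_+ 0) (m≤n⇒m∸n≡0 (≤-trans (s≤s z≤n) 2≤h))))
  where
  h : ℕ
  h = ⌊ k /2⌋
  2≤h : 2 ≤ h
  2≤h = 2m≤n⇒m≤⌊n/2⌋ {2} 4≤k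
  1≢h : 1 ≢ h
  1≢h 1≡h = <-irrefl 1≡h 2≤h
  h+1+h≡k : h + suc h ≡ k
  h+1+h≡k = trans (cong (_+_ h) (sym c≡1+h)) (⌊n/2⌋+⌈n/2⌉≡n k)
  regroup : ∀ h → h + h + (1 + 0) ≡ h + suc h
  regroup = solve-∀

sum-upTo-suc : ∀ (f : ℕ → ℕ) N → sum (map f (upTo (suc N))) ≡ sum (map f (upTo N)) + f N
sum-upTo-suc f N = begin
  sum (map f (upTo (suc N)))        ≡⟨ cong (sum ∘ map f) (upTo-∷ʳ N) ⟨
  sum (map f (upTo N ++ [ N ]))     ≡⟨ cong sum (map-++ f (upTo N) [ N ]) ⟩
  sum (map f (upTo N) ++ [ f N ])   ≡⟨ sum-++ (map f (upTo N)) [ f N ] ⟩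
  sum (map f (upTo N)) + (f N + 0)  ≡⟨ cong (_+_ (sum (map f (upTo N)))) (+-identityʳ (f N)) ⟩
  sum (map f (upTo N)) + f N        ∎
  where open ≡-Reasoning

module _ (f : ℕ → ℕ) (q : ℕ) (vanishes : ∀ j → j ≢ q → f j ≡ 0) where

  sum-upTo-below-support : ∀ {N} → N ≤ q → sum (map f (upTo N)) ≡ 0
  sum-upTo-below-support {zero}  _     = refl
  sum-upTo-below-support {suc N} 1+N≤q = trans (sum-upTo-suc f N)
    (cong₂ _+_ (sum-upTo-below-support (≤-trans (n≤1+n N) 1+N≤q)) (vanishes N (λ N≡q → <-irrefl N≡q 1+N≤q)))

  sum-upTo-above-support : ∀ {N} → q < N → sum (map f (upTo N)) ≡ f q
  sum-upTo-above-support {suc N} q<1+N with m≤n⇒m<n∨m≡n (≤-pred q<1+N)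
  ... | inj₁ q<N = trans (sum-upTo-suc f N)
    (trans (cong₂ _+_ (sum-upTo-above-support q<N) (vanishes N (λ N≡q → <-irrefl (sym N≡q) q<N))) (+-identityʳ (f q)))
  ... | inj₂ refl = trans (sum-upTo-suc f q) (cong (_+ f q) (sum-upTo-below-support ≤-refl))

tailWeight : ℕ → ℕ → List ℕ → ℕ
tailWeight i k xs = sum (map (λ j → (i ∸ j) * mult (k ∸ j) xs) (range 0 (i ∸ 1)))

-- The part p is counted by d_{k-j} only for j = k - p, with weight i - (k - p) = p - m when positive.
tailWeight-part : ∀ {i m p} → 1 ≤ p → p ≤ i + m →
  sum (map (λ j → (i ∸ j) * indicator (p ≡ᵇ (i + m ∸ j))) (range 0 (i ∸ 1))) ≡ p ∸ m
tailWeight-part {i} {m} {p} 1≤p p≤k =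
  trans (cong sum (sym (map-∘ (upTo (suc (i ∸ 1)))))) (by-cases (m <? p))
  where
  k q : ℕ
  k = i + m
  q = k ∸ p
  f : ℕ → ℕ
  f j = (i ∸ j) * indicator (p ≡ᵇ (k ∸ j))
  vanishes : ∀ j → j ≢ q → f j ≡ 0
  vanishes j j≢q = trans (cong ((i ∸ j) *_) (indicator-≢ p≢k∸j)) (*-zeroʳ (i ∸ j))
    where
    p≢k∸j : p ≢ k ∸ j
    p≢k∸j p≡k∸j = j≢q (trans (sym (m∸[m∸n]≡n j≤k)) (cong (k ∸_) (sym p≡k∸j)))
      where
      j≤k : j ≤ k
      j≤k = <⇒≤ (m∸n≢0⇒n<m (λ eq → <-irrefl (sym (trans p≡k∸j eq)) 1≤p))
  f-at-q : f q ≡ i ∸ q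
  f-at-q = trans (cong ((i ∸ q) *_) (indicator-≡ (sym (m∸[m∸n]≡n p≤k)))) (*-identityʳ (i ∸ q))
  by-cases : Dec (m < p) → sum (map f (upTo (suc (i ∸ 1)))) ≡ p ∸ m
  by-cases (yes m<p) = begin
    sum (map f (upTo (suc (i ∸ 1)))) ≡⟨ cong (sum ∘ map f ∘ upTo) (m+[n∸m]≡n (≤-trans (s≤s z≤n) q<i)) ⟩
    sum (map f (upTo i))             ≡⟨ sum-upTo-above-support f q vanishes q<i ⟩
    f q                              ≡⟨ f-at-q ⟩
    i ∸ (k ∸ p)                      ≡⟨ cong (λ z → i ∸ (k ∸ z)) (m+[n∸m]≡n (<⇒≤ m<p)) ⟨
    i ∸ (i + m ∸ (m + (p ∸ m)))      ≡⟨ cong (λ z → i ∸ (z ∸ (m + (p ∸ m)))) (+-comm i m) ⟩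
    i ∸ (m + i ∸ (m + (p ∸ m)))      ≡⟨ cong (i ∸_) ([m+n]∸[m+o]≡n∸o m i (p ∸ m)) ⟩
    i ∸ (i ∸ (p ∸ m))                ≡⟨ m∸[m∸n]≡n (≤-trans (∸-monoˡ-≤ m p≤k) (≤-reflexive (m+n∸n≡m i m))) ⟩
    p ∸ m                            ∎
    where
    open ≡-Reasoning
    q<i : q < i
    q<i = <-≤-trans (∸-monoʳ-< m<p p≤k) (≤-reflexive (m+n∸n≡m i m))
  by-cases (no m≮p) = trans sum≡0 (sym (m≤n⇒m∸n≡0 p≤m))
    where
    p≤m : p ≤ m
    p≤m = ≮⇒≥ m≮p
    f-at-q≡0 : f q ≡ 0
    f-at-q≡0 = trans f-at-q (m≤n⇒m∸n≡0 (≤-trans (≤-reflexive (sym (m+n∸n≡m i m))) (∸-monoʳ-≤ k p≤m)))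
    sum≡0 : sum (map f (upTo (suc (i ∸ 1)))) ≡ 0
    sum≡0 with q <? suc (i ∸ 1)
    ... | yes q<N = trans (sum-upTo-above-support f q vanishes q<N) f-at-q≡0
    ... | no q≮N = sum-upTo-below-support f q vanishes (≮⇒≥ q≮N)

sum-map-*-mult-∷ : ∀ (w g : ℕ → ℕ) p xs js →
  sum (map (λ j → w j * mult (g j) (p ∷ xs)) js)
  ≡ sum (map (λ j → w j * indicator (p ≡ᵇ g j)) js) + sum (map (λ j → w j * mult (g j) xs) js)
sum-map-*-mult-∷ w g p xs []       = refl
sum-map-*-mult-∷ w g p xs (j ∷ js) =
  trans (cong₂ (λ c r → w j * c + r) (mult-∷ (g j) p xs) (sum-map-*-mult-∷ w g p xs js))
        (regroup (w j) (indicator (p ≡ᵇ g j)) (mult (g j) xs) _ _)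
  where
  regroup : ∀ w a b A B → w * (a + b) + (A + B) ≡ (w * a + A) + (w * b + B)
  regroup = solve-∀

sum-map-*0 : ∀ (w : ℕ → ℕ) js → sum (map (λ j → w j * 0) js) ≡ 0
sum-map-*0 w []       = refl
sum-map-*0 w (j ∷ js) = cong₂ _+_ (*-zeroʳ (w j)) (sum-map-*0 w js)

tailWeight≡excess : ∀ {i m} xs → All (1 ≤_) xs → All (_≤ i + m) xs → tailWeight i (i + m) xs ≡ excess m xs
tailWeight≡excess {i} []       _          _          = sum-map-*0 (i ∸_) (range 0 (i ∸ 1))
tailWeight≡excess {i} {m} (p ∷ xs) (1≤p ∷ ps≥1) (p≤k ∷ ps≤k) =
  trans (sum-map-*-mult-∷ (i ∸_) (i + m ∸_) p xs (range 0 (i ∸ 1)))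
        (cong₂ _+_ (tailWeight-part {i} {m} 1≤p p≤k) (tailWeight≡excess {i} {m} xs ps≥1 ps≤k))

affine≡⊖ : ∀ m N b t → (+ m ℤ.* + N - + b) +ℤ + t ≡ (m * N + t) ⊖ b
affine≡⊖ m N b t = begin
  (+ m ℤ.* + N - + b) +ℤ + t  ≡⟨ move (+ m ℤ.* + N) (+ b) (+ t) ⟩
  (+ m ℤ.* + N +ℤ + t) - + b  ≡⟨ cong (λ z → (z +ℤ + t) - + b) (pos-* m N) ⟨
  (+ (m * N) +ℤ + t) - + b    ≡⟨ cong (_- + b) (pos-+ (m * N) t) ⟨
  + (m * N + t) - + b         ≡⟨ m-n≡m⊖n (m * N + t) b ⟩
  (m * N + t) ⊖ b             ∎
  where
  open ≡-Reasoning
  move : ∀ (x y z : ℤ) → (x - y) +ℤ z ≡ (x +ℤ z) - y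
  move = ℤ-Solver.solve-∀

m⊖n≡+o⇒o+n≡m : ∀ {a b c} → a ⊖ b ≡ + c → c + b ≡ a
m⊖n≡+o⇒o+n≡m {a} {b} {c} eq = +-injective (begin
  + (c + b)            ≡⟨ pos-+ c b ⟩
  + c +ℤ + b           ≡⟨ cong (_+ℤ + b) eq ⟨
  (a ⊖ b) +ℤ + b       ≡⟨ cong (_+ℤ + b) (m-n≡m⊖n a b) ⟨
  (+ a - + b) +ℤ + b   ≡⟨ cancel (+ a) (+ b) ⟩
  + a                  ∎)
  where
  open ≡-Reasoning
  cancel : ∀ (x y : ℤ) → (x - y) +ℤ y ≡ x
  cancel = ℤ-Solver.solve-∀

nPrime-on-partition : ∀ {N k λs i m} → λs ∈ partitions k → i + m ≡ k →
                      nPrime (+ N) k λs i ≡ (m * N + 2 * excess m λs) ⊖ (2 * i)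
nPrime-on-partition {N} {_} {λs} {i} {m} λ∈ refl = begin
  nPrime (+ N) (i + m) λs i                                    ≡⟨ affine≡⊖ (i + m ∸ i) N (2 * i) (2 * tailWeight i (i + m) λs) ⟩
  ((i + m ∸ i) * N + 2 * tailWeight i (i + m) λs) ⊖ (2 * i)   ≡⟨ cong₂ (λ a t → (a * N + 2 * t) ⊖ (2 * i)) (m+n∸m≡n i m) T≡ ⟩
  (m * N + 2 * excess m λs) ⊖ (2 * i)                          ∎
  where
  open ≡-Reasoning
  P : IsPartition (i + m) (i + m) λs
  P = partitions-sound λ∈
  T≡ : tailWeight i (i + m) λs ≡ excess m λs
  T≡ = tailWeight≡excess {i} {m} λs (parts≥1 P) (parts≤ P)

-- A recursive call of the depth recursion from (N, k) to (n′, d): in the paper's notation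
-- m = k - i is the part size with d = d_m(λ), and T = Σ_{j<i} (i - j) d_{k-j} = Σ_{p ∈ λ} (p ∸ m).
record Call (N k n′ d : ℕ) : Set where
  field
    i m T : ℕ
    1≤m : 1 ≤ m
    i+m≡k : i + m ≡ k
    T+m*d≤k : T + m * d ≤ k
    T>0⇒T+m*d+m≤k : 0 < T → T + m * d + m ≤ k
    m≡1⇒k≤d+2*T : m ≡ 1 → k ≤ d + 2 * T
    n′+2*i≡m*N+2*T : n′ + 2 * i ≡ m * N + 2 * T

call : ∀ {N k λs i n′} → λs ∈ partitions k → i < k → nPrime (+ N) k λs i ≡ + n′ → Call N k n′ (mult (k ∸ i) λs)
call {N} {k} {λs} {i} λ∈ i<k n′≡ = record
  { i = i
  ; m = m
  ; T = excess m λs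
  ; 1≤m = m<n⇒0<n∸m i<k
  ; i+m≡k = i+m≡k
  ; T+m*d≤k = subst (excess m λs + m * mult m λs ≤_) (sum≡ P) (excess+m*mult≤sum m λs)
  ; T>0⇒T+m*d+m≤k = subst (excess m λs + m * mult m λs + m ≤_) (sum≡ P) ∘ excess>0⇒excess+m*mult+m≤sum m λs
  ; m≡1⇒k≤d+2*T = unit-parts
  ; n′+2*i≡m*N+2*T = m⊖n≡+o⇒o+n≡m (trans (sym (nPrime-on-partition {N} {k} {λs} {i} {m} λ∈ i+m≡k)) n′≡)
  }
  where
  m : ℕ
  m = k ∸ i
  i+m≡k : i + m ≡ k
  i+m≡k = m+[n∸m]≡n (<⇒≤ i<k)
  P : IsPartition k k λs
  P = partitions-sound λ∈
  unit-parts : m ≡ 1 → k ≤ mult m λs + 2 * excess m λs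
  unit-parts m≡1 = subst (λ m → k ≤ mult m λs + 2 * excess m λs) (sym m≡1)
                         (subst (_≤ mult 1 λs + 2 * excess 1 λs) (sum≡ P) (sum≤mult₁+2*excess₁ (parts≥1 P)))

-- Upper bound

-- Floored at 1, the depth of every non-initial pair: for small N and k ≥ 4 the formula drops below 1.
generalBound : ℕ → ℕ → ℕ
generalBound N k = 1 ⊔ (⌈ ⌊ k /2⌋ * N /2⌉ + 1 ∸ ⌈ k /2⌉)

generalBound≤ : ∀ N k → generalBound N k ≤ suc ⌈ ⌊ k /2⌋ * N /2⌉
generalBound≤ N k = ⊔-lub (s≤s z≤n) (≤-trans (m∸n≤m (x + 1) ⌈ k /2⌉) (≤-reflexive (+-comm x 1)))
  where
  x : ℕ
  x = ⌈ ⌊ k /2⌋ * N /2⌉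

<generalBound : ∀ {V N k} → V + ⌈ k /2⌉ ≤ ⌈ ⌊ k /2⌋ * N /2⌉ → V < generalBound N k
<generalBound {V} {N} {k} le =
  ≤-trans (m+n≤o⇒m≤o∸n (suc V) (subst (_≤ ⌈ ⌊ k /2⌋ * N /2⌉ + 1) (+-comm (V + ⌈ k /2⌉) 1) (+-monoˡ-≤ 1 le)))
          (m≤n⊔m 1 _)

generalBound-exact : ∀ {N k} → 2 * ⌈ k /2⌉ ≤ ⌊ k /2⌋ * N → generalBound N k ≡ suc ⌈ ⌊ k /2⌋ * N ∸ 2 * ⌈ k /2⌉ /2⌉
generalBound-exact {N} {k} room = cong (1 ⊔_) (begin
  ⌈ ⌊ k /2⌋ * N /2⌉ + 1 ∸ c  ≡⟨ cong (λ y → y + 1 ∸ c) (⌈m/2⌉≡⌈[m∸2n]/2⌉+n {n = c} room) ⟩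
  x + c + 1 ∸ c              ≡⟨ cong (_∸ c) (regroup x c) ⟩
  suc x + c ∸ c              ≡⟨ m+n∸n≡m (suc x) c ⟩
  suc x                      ∎)
  where
  open ≡-Reasoning
  c x : ℕ
  c = ⌈ k /2⌉
  x = ⌈ ⌊ k /2⌋ * N ∸ 2 * c /2⌉
  regroup : ∀ x c → x + c + 1 ≡ suc x + c
  regroup = solve-∀

depthBound : ℕ → ℕ → ℕ
depthBound zero      _                      = 0
depthBound (suc n)   zero                   = 0
depthBound (suc n)   (suc zero)             = 0
depthBound (suc n)   (suc (suc (suc zero))) = (suc n + 3) / 4
depthBound N@(suc _) k                      = generalBound N k

depthBoundℤ : ℤ → ℕ → ℕ
depthBoundℤ (+ n)    k = depthBound n k
depthBoundℤ -[1+ _ ] _ = 0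

depthBound-general : ∀ {n k} → 2 ≤ k → k ≢ 3 → depthBound (suc n) k ≡ generalBound (suc n) k
depthBound-general {k = suc zero}                   (s≤s ()) _
depthBound-general {k = suc (suc zero)}             _ _   = refl
depthBound-general {k = suc (suc (suc zero))}       _ k≢3 = ⊥-elim (k≢3 refl)
depthBound-general {k = suc (suc (suc (suc _)))}    _ _   = refl

depthBound-2 : ∀ n → depthBound n 2 ≡ ⌈ n /2⌉
depthBound-2 zero    = refl
depthBound-2 (suc n) = cong (1 ⊔_) (trans (m+n∸n≡m ⌈ 1 * suc n /2⌉ 1) (cong ⌈_/2⌉ (*-identityˡ (suc n))))

1≤depthBound : ∀ {n k} → 2 ≤ k → 1 ≤ depthBound (suc n) k
1≤depthBound {k = suc zero}                (s≤s ())
1≤depthBound {n} {k@(suc (suc zero))}       _ = m≤m⊔n 1 (⌈ ⌊ k /2⌋ * suc n /2⌉ + 1 ∸ ⌈ k /2⌉)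
1≤depthBound {n} {suc (suc (suc zero))}    _ =
  subst (1 ≤_) (sym (trans (cong (_/ 4) (cong suc (+-comm n 3))) ([4+n]/4≡1+n/4 n))) (s≤s z≤n)
1≤depthBound {n} {k@(suc (suc (suc (suc _))))} _ = m≤m⊔n 1 (⌈ ⌊ k /2⌋ * suc n /2⌉ + 1 ∸ ⌈ k /2⌉)

module Slack {N k n′ d₁} (c : Call N k n′ (suc d₁)) (0<n′ : 0 < n′) where
  open Call c

  slack : ℕ
  slack = k ∸ (T + m * suc d₁)

  T+m*d+slack≡k : T + m * suc d₁ + slack ≡ k
  T+m*d+slack≡k = m+[n∸m]≡n T+m*d≤k

  m*d≤k : m * suc d₁ ≤ k
  m*d≤k = m+n≤o⇒n≤o T T+m*d≤k

  m*2d₁≡2*[m*d₁] : m * (2 * d₁) ≡ 2 * (m * d₁)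
  m*2d₁≡2*[m*d₁] = trans (sym (*-assoc m 2 d₁)) (trans (cong (_* d₁) (*-comm m 2)) (*-assoc 2 m d₁))

  slack≥m : 0 < T → m ≤ slack
  slack≥m 0<T = +-cancelˡ-≤ (T + m * suc d₁) m slack (subst (T + m * suc d₁ + m ≤_) (sym T+m*d+slack≡k) (T>0⇒T+m*d+m≤k 0<T))

  i≡T+m*d₁+slack : i ≡ T + m * d₁ + slack
  i≡T+m*d₁+slack = +-cancelʳ-≡ m i _ (trans i+m≡k (trans (sym T+m*d+slack≡k) (regroup T m d₁ slack)))
    where
    regroup : ∀ T m d R → T + m * suc d + R ≡ T + m * d + R + m
    regroup = solve-∀

  m*N≡ : m * N ≡ n′ + 2 * slack + 2 * (m * d₁)
  m*N≡ = +-cancelʳ-≡ (2 * T) _ _ (begin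
    m * N + 2 * T                          ≡⟨ n′+2*i≡m*N+2*T ⟨
    n′ + 2 * i                             ≡⟨ cong (λ x → n′ + 2 * x) i≡T+m*d₁+slack ⟩
    n′ + 2 * (T + m * d₁ + slack)          ≡⟨ regroup n′ T (m * d₁) slack ⟩
    n′ + 2 * slack + 2 * (m * d₁) + 2 * T  ∎)
    where
    open ≡-Reasoning
    regroup : ∀ n T x R → n + 2 * (T + x + R) ≡ n + 2 * R + 2 * x + 2 * T
    regroup = solve-∀

  2d₁<N : 2 * d₁ < N
  2d₁<N = *-cancelˡ-< m (2 * d₁) N (begin-strict
    m * (2 * d₁)                     ≡⟨ m*2d₁≡2*[m*d₁] ⟩
    2 * (m * d₁)                     <⟨ +-monoˡ-< (2 * (m * d₁)) (<-≤-trans 0<n′ (m≤m+n n′ (2 * slack))) ⟩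
    n′ + 2 * slack + 2 * (m * d₁)    ≡⟨ m*N≡ ⟨
    m * N                            ∎)
    where open ≤-Reasoning

  m*[N∸2d₁]≡n′+2*slack : m * (N ∸ 2 * d₁) ≡ n′ + 2 * slack
  m*[N∸2d₁]≡n′+2*slack = begin
    m * (N ∸ 2 * d₁)                                  ≡⟨ *-distribˡ-∸ m N (2 * d₁) ⟩
    m * N ∸ m * (2 * d₁)                              ≡⟨ cong₂ _∸_ m*N≡ m*2d₁≡2*[m*d₁] ⟩
    n′ + 2 * slack + 2 * (m * d₁) ∸ 2 * (m * d₁)     ≡⟨ m+n∸n≡m (n′ + 2 * slack) (2 * (m * d₁)) ⟩
    n′ + 2 * slack                                    ∎
    where open ≡-Reasoning

  scaled-call-bound : ∀ a h → a * m ≤ h → a * (n′ + 2 * slack) + h * (2 * d₁) ≤ h * N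
  scaled-call-bound a h am≤h = begin
    a * (n′ + 2 * slack) + h * (2 * d₁)    ≡⟨ cong (λ x → a * x + h * (2 * d₁)) m*[N∸2d₁]≡n′+2*slack ⟨
    a * (m * (N ∸ 2 * d₁)) + h * (2 * d₁)  ≡⟨ cong (_+ h * (2 * d₁)) (*-assoc a m (N ∸ 2 * d₁)) ⟨
    a * m * (N ∸ 2 * d₁) + h * (2 * d₁)    ≤⟨ +-monoˡ-≤ (h * (2 * d₁)) (*-monoˡ-≤ (N ∸ 2 * d₁) am≤h) ⟩
    h * (N ∸ 2 * d₁) + h * (2 * d₁)        ≡⟨ *-distribˡ-+ h (N ∸ 2 * d₁) (2 * d₁) ⟨
    h * (N ∸ 2 * d₁ + 2 * d₁)              ≡⟨ cong (h *_) (m∸n+n≡m (<⇒≤ 2d₁<N)) ⟩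
    h * N                                  ∎
    where open ≤-Reasoning

⌈k/2⌉≤R+⌊k/2⌋ : ∀ {k T m R} → 1 ≤ m → m ≤ ⌊ k /2⌋ → T + m * 2 + R ≡ k → (0 < T → m ≤ R) → ⌈ k /2⌉ ≤ R + ⌊ k /2⌋
⌈k/2⌉≤R+⌊k/2⌋ {k} {zero} {m} {R} _ m≤h k≡ _ = begin
  ⌈ k /2⌉          ≡⟨ cong ⌈_/2⌉ (trans (sym k≡) (regroup m R)) ⟩
  ⌈ R + 2 * m /2⌉  ≡⟨ ⌈m+2n/2⌉≡⌈m/2⌉+n R m ⟩
  ⌈ R /2⌉ + m      ≤⟨ +-mono-≤ (⌈n/2⌉≤n R) m≤h ⟩
  R + ⌊ k /2⌋      ∎
  where
  open ≤-Reasoning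
  regroup : ∀ m R → 0 + m * 2 + R ≡ R + 2 * m
  regroup = solve-∀
⌈k/2⌉≤R+⌊k/2⌋ {k} {suc T} 1≤m _ _ m≤R = ≤-trans (⌈n/2⌉≤1+⌊n/2⌋ k) (+-monoˡ-≤ ⌊ k /2⌋ (≤-trans 1≤m (m≤R z<s)))

call-bound-d2 : ∀ {N k e} → Call N k (suc e) 2 → suc e + 2 * ⌈ k /2⌉ ≤ ⌊ k /2⌋ * N
call-bound-d2 {N} {k} {e} c = begin
  suc e + 2 * ⌈ k /2⌉                    ≤⟨ +-monoʳ-≤ (suc e) (*-monoʳ-≤ 2 (⌈k/2⌉≤R+⌊k/2⌋ 1≤m m≤h T+m*d+slack≡k slack≥m)) ⟩
  suc e + 2 * (slack + h)                ≡⟨ regroup (suc e) slack h ⟩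
  1 * (suc e + 2 * slack) + h * (2 * 1)  ≤⟨ scaled-call-bound 1 h (subst (_≤ h) (sym (*-identityˡ m)) m≤h) ⟩
  h * N                                  ∎
  where
  open ≤-Reasoning
  open Call c
  open Slack c z<s
  h : ℕ
  h = ⌊ k /2⌋
  m≤h : m ≤ h
  m≤h = 2m≤n⇒m≤⌊n/2⌋ (subst (_≤ k) (*-comm m 2) m*d≤k)
  regroup : ∀ n R h → n + 2 * (R + h) ≡ 1 * (n + 2 * R) + h * (2 * 1)
  regroup = solve-∀

call-bound-d3 : ∀ {N k e} → Call N k (suc e) 3 → k ≢ 3 → 2 * ((suc e + 3) / 4 + ⌈ k /2⌉) ≤ ⌊ k /2⌋ * N
call-bound-d3 {N} {k} {e} c k≢3 = begin
  2 * (V + ⌈ k /2⌉)                      ≡⟨ *-distribˡ-+ 2 V ⌈ k /2⌉ ⟩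
  2 * V + 2 * ⌈ k /2⌉                    ≤⟨ +-mono-≤ (2[n+3]/4≤n+1 (s≤s z≤n)) (*-monoʳ-≤ 2 (⌈n/2⌉≤1+⌊n/2⌋ k)) ⟩
  suc e + 1 + 2 * suc h                  ≡⟨ regroup₁ (suc e) h ⟩
  suc e + 2 * h + 3                      ≤⟨ +-monoʳ-≤ (suc e + 2 * h) (≤-trans 3≤2h (m≤n+m (2 * h) (2 * slack))) ⟩
  suc e + 2 * h + (2 * slack + 2 * h)    ≡⟨ regroup₂ (suc e) slack h ⟩
  1 * (suc e + 2 * slack) + h * (2 * 2)  ≤⟨ scaled-call-bound 1 h (subst (_≤ h) (sym (*-identityˡ m)) m≤h) ⟩
  h * N                                  ∎
  where
  open ≤-Reasoning
  open Call c
  open Slack c z<s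
  V h : ℕ
  V = (suc e + 3) / 4
  h = ⌊ k /2⌋
  3m≤k : 3 * m ≤ k
  3m≤k = subst (_≤ k) (*-comm m 3) m*d≤k
  3≤2h : 3 ≤ 2 * h
  3≤2h = ≤-trans (n≤1+n 3) (*-monoʳ-≤ 2 (2m≤n⇒m≤⌊n/2⌋ {2} (≤∧≢⇒< (≤-trans (*-monoʳ-≤ 3 1≤m) 3m≤k) (k≢3 ∘ sym))))
  m≤h : m ≤ h
  m≤h = 2m≤n⇒m≤⌊n/2⌋ (≤-trans (*-monoˡ-≤ m (n≤1+n 2)) 3m≤k)
  regroup₁ : ∀ n h → n + 1 + 2 * suc h ≡ n + 2 * h + 3
  regroup₁ = solve-∀
  regroup₂ : ∀ n R h → n + 2 * h + (2 * R + 2 * h) ≡ 1 * (n + 2 * R) + h * (2 * 2)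
  regroup₂ = solve-∀

call-bound-d≥4 : ∀ {N k e d₃} → Call N k (suc e) (4 + d₃) → ⌊ 4 + d₃ /2⌋ * suc e + 2 * (1 + ⌈ k /2⌉) ≤ ⌊ k /2⌋ * N
call-bound-d≥4 {N} {k} {e} {d₃} c = begin
  h′ * suc e + 2 * (1 + ⌈ k /2⌉)                 ≤⟨ +-mono-≤ (*-monoʳ-≤ h′ (m≤m+n (suc e) (2 * slack))) 2+2⌈k/2⌉≤h*2d₁ ⟩
  h′ * (suc e + 2 * slack) + h * (2 * (3 + d₃))  ≤⟨ scaled-call-bound h′ h h′m≤h ⟩
  h * N                                          ∎
  where
  open ≤-Reasoning
  open Call c
  open Slack c z<s
  h h′ : ℕ
  h = ⌊ k /2⌋
  h′ = ⌊ 4 + d₃ /2⌋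
  m*d≤k′ : (4 + d₃) * m ≤ k
  m*d≤k′ = subst (_≤ k) (*-comm m (4 + d₃)) m*d≤k
  1≤h : 1 ≤ h
  1≤h = 2m≤n⇒m≤⌊n/2⌋ (≤-trans (m≤m+n 2 (2 + d₃)) (≤-trans (subst (_≤ (4 + d₃) * m) (*-identityʳ (4 + d₃)) (*-monoʳ-≤ (4 + d₃) 1≤m)) m*d≤k′))
  h′m≤h : h′ * m ≤ h
  h′m≤h = 2m≤n⇒m≤⌊n/2⌋ (subst (_≤ k) (*-assoc 2 h′ m) (≤-trans (*-monoˡ-≤ m (2⌊n/2⌋≤n (4 + d₃))) m*d≤k′))
  2+2⌈k/2⌉≤h*2d₁ : 2 * (1 + ⌈ k /2⌉) ≤ h * (2 * (3 + d₃))
  2+2⌈k/2⌉≤h*2d₁ = begin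
    2 * (1 + ⌈ k /2⌉)  ≤⟨ *-monoʳ-≤ 2 (s≤s (⌈n/2⌉≤1+⌊n/2⌋ k)) ⟩
    2 * (2 + h)        ≡⟨ regroup₁ h ⟩
    2 * h + 4 * 1      ≤⟨ +-monoʳ-≤ (2 * h) (*-monoʳ-≤ 4 1≤h) ⟩
    2 * h + 4 * h      ≡⟨ regroup₂ h ⟩
    h * (2 * 3)        ≤⟨ *-monoʳ-≤ h (*-monoʳ-≤ 2 (m≤m+n 3 d₃)) ⟩
    h * (2 * (3 + d₃)) ∎
    where
    regroup₁ : ∀ h → 2 * (2 + h) ≡ 2 * h + 4 * 1
    regroup₁ = solve-∀
    regroup₂ : ∀ h → 2 * h + 4 * h ≡ h * (2 * 3)
    regroup₂ = solve-∀

depthBound-call≢3 : ∀ {N k e d} → Call N k (suc e) d → k ≢ 3 → 2 ≤ d →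
                    depthBound (suc e) d + ⌈ k /2⌉ ≤ ⌈ ⌊ k /2⌋ * N /2⌉
depthBound-call≢3 {d = zero}     _ _ ()
depthBound-call≢3 {d = suc zero} _ _ (s≤s ())
depthBound-call≢3 {N} {k} {e} {suc (suc zero)} c _ _ =
  subst (λ x → x + ⌈ k /2⌉ ≤ ⌈ ⌊ k /2⌋ * N /2⌉) (sym (depthBound-2 (suc e)))
        (m+2n≤o⇒⌈m/2⌉+n≤⌈o/2⌉ {suc e} {⌈ k /2⌉} (call-bound-d2 c))
depthBound-call≢3 {d = suc (suc (suc zero))} c k≢3 _ = 2m≤n⇒m≤⌈n/2⌉ (call-bound-d3 c k≢3)
depthBound-call≢3 {k = k} {e} {suc (suc (suc (suc d₃)))} c _ _ = begin
  depthBound (suc e) (4 + d₃) + ⌈ k /2⌉  ≤⟨ +-monoˡ-≤ ⌈ k /2⌉ (generalBound≤ (suc e) (4 + d₃)) ⟩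
  suc (x + ⌈ k /2⌉)                      ≡⟨ +-suc x ⌈ k /2⌉ ⟨
  x + (1 + ⌈ k /2⌉)                      ≤⟨ m+2n≤o⇒⌈m/2⌉+n≤⌈o/2⌉ {⌊ 4 + d₃ /2⌋ * suc e} {1 + ⌈ k /2⌉} (call-bound-d≥4 c) ⟩
  ⌈ ⌊ k /2⌋ * _ /2⌉                      ∎
  where
  open ≤-Reasoning
  x : ℕ
  x = ⌈ ⌊ 4 + d₃ /2⌋ * suc e /2⌉

call-from-3 : ∀ {N n′ d} → Call N 3 n′ d → 2 ≤ d → d ≡ 3 × n′ + 4 ≡ N
call-from-3 {d = zero}     _ ()
call-from-3 {d = suc zero} _ (s≤s ())
call-from-3 {d = d} record { m = suc (suc m) ; T = T ; T+m*d≤k = packed } 2≤d =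
  ⊥-elim (<⇒≱ (n<1+n 3) (≤-trans (*-mono-≤ {2} {suc (suc m)} (s≤s (s≤s z≤n)) 2≤d) (m+n≤o⇒n≤o T packed)))
call-from-3 {d = suc (suc zero)} record { m = suc zero ; T = zero ; m≡1⇒k≤d+2*T = unit } _ =
  ⊥-elim (<⇒≱ (n<1+n 2) (unit refl))
call-from-3 {d = suc (suc zero)} record { m = suc zero ; T = suc T ; T>0⇒T+m*d+m≤k = excess } _ =
  ⊥-elim (<⇒≱ (n<1+n 3) (≤-trans (s≤s (m≤n+m 3 T)) (≤-trans (≤-reflexive (regroup T)) (excess z<s))))
  where
  regroup : ∀ T → suc (T + 3) ≡ suc T + 1 * 2 + 1
  regroup = solve-∀
call-from-3 {d = suc (suc (suc zero))} record { m = suc zero ; T = suc T ; T+m*d≤k = packed } _ =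
  ⊥-elim (<⇒≱ (n<1+n 3) (≤-trans (s≤s (m≤n+m 3 T)) (≤-trans (≤-reflexive (regroup T)) packed)))
  where
  regroup : ∀ T → suc (T + 3) ≡ suc T + 1 * 3
  regroup = solve-∀
call-from-3 {N} {n′} {suc (suc (suc zero))} record { i = i ; m = suc zero ; T = zero ; i+m≡k = i+1≡3 ; n′+2*i≡m*N+2*T = eq } _ =
  refl , (begin
    n′ + 4          ≡⟨ cong (λ x → n′ + 2 * x) (+-cancelʳ-≡ 1 i 2 i+1≡3) ⟨
    n′ + 2 * i      ≡⟨ eq ⟩
    1 * N + 2 * 0   ≡⟨ regroup N ⟩
    N               ∎)
  where
  open ≡-Reasoning
  regroup : ∀ N → 1 * N + 2 * 0 ≡ N
  regroup = solve-∀
call-from-3 {d = suc (suc (suc (suc d)))} record { m = suc zero ; T = T ; T+m*d≤k = packed } _ =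
  ⊥-elim (<⇒≱ (n<1+n 3) (≤-trans (m≤m+n 4 d) (≤-trans (≤-reflexive (regroup d)) (m+n≤o⇒n≤o T packed))))
  where
  regroup : ∀ d → 4 + d ≡ 1 * (4 + d)
  regroup = solve-∀

depthBound-call : ∀ {n k e d} → Call (suc n) k (suc e) d → 2 ≤ k → depthBound (suc e) d < depthBound (suc n) k
depthBound-call {d = zero}     _ 2≤k = 1≤depthBound 2≤k
depthBound-call {d = suc zero} _ 2≤k = 1≤depthBound 2≤k
depthBound-call {k = k} {d = suc (suc _)} c 2≤k with k ≟ 3
depthBound-call {e = e} c _ | yes refl with call-from-3 c (s≤s (s≤s z≤n))
... | refl , refl = ≤-reflexive (begin
  suc ((suc e + 3) / 4)    ≡⟨ [4+n]/4≡1+n/4 (suc e + 3) ⟨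
  (4 + (suc e + 3)) / 4    ≡⟨ cong (_/ 4) (regroup e) ⟩
  (suc e + 4 + 3) / 4      ∎)
  where
  open ≡-Reasoning
  regroup : ∀ e → 4 + (suc e + 3) ≡ suc e + 4 + 3
  regroup = solve-∀
depthBound-call {e = e} {d} c 2≤k | no k≢3 =
  subst (depthBound (suc e) d <_) (sym (depthBound-general 2≤k k≢3))
        (<generalBound (depthBound-call≢3 c k≢3 (s≤s (s≤s z≤n))))

depthBoundℤ-call : ∀ {n k λs i} → 2 ≤ k → λs ∈ partitions k → i < k →
                   depthBoundℤ (nPrime (+ suc n) k λs i) (mult (k ∸ i) λs) < depthBound (suc n) k
depthBoundℤ-call {n} {k} {λs} {i} 2≤k λ∈ i<k with nPrime (+ suc n) k λs i in n′≡
... | -[1+ _ ] = 1≤depthBound 2≤k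
... | + zero   = 1≤depthBound 2≤k
... | + suc e  = depthBound-call (call λ∈ i<k n′≡) 2≤k

Dfuel≤depthBound : ∀ f x k → Dfuel f x k ≤ depthBoundℤ x k
Dfuel≤depthBound zero    _          _                = z≤n
Dfuel≤depthBound (suc f) -[1+ _ ]   _                = z≤n
Dfuel≤depthBound (suc f) (+ zero)   _                = z≤n
Dfuel≤depthBound (suc f) (+ suc n)  zero             = z≤n
Dfuel≤depthBound (suc f) (+ suc n)  (suc zero)       = z≤n
Dfuel≤depthBound (suc f) (+ suc n) k@(suc (suc k₀)) =
  maxList< (concatMap calls (partitions k)) (1≤depthBound {n} 2≤k) every-call
  where
  2≤k : 2 ≤ k
  2≤k = s≤s (s≤s z≤n)
  call-depth : List ℕ → ℕ → ℕ
  call-depth λs i = Dfuel f (nPrime (+ suc n) k λs i) (mult (k ∸ i) λs)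
  calls : List ℕ → List ℕ
  calls λs = map (call-depth λs) (range 0 (k ∸ 1))
  every-call : ∀ {y} → y ∈ concatMap calls (partitions k) → y < depthBound (suc n) k
  every-call y∈ with λs , λ∈ , y∈′ ← find (∈-concatMap⁻ calls {xs = partitions k} y∈)
                with i , i∈ , refl ← ∈-map⁻ (call-depth λs) y∈′ =
    ≤-trans (s≤s (Dfuel≤depthBound f (nPrime (+ suc n) k λs i) (mult (k ∸ i) λs)))
            (depthBoundℤ-call {n} {k} {λs} {i} 2≤k λ∈ (s≤s (proj₂ (∈-range⁻ {0} {k ∸ 1} i∈))))

-- Lower bound

Dfuel-call : ∀ {f n k λs i} → λs ∈ partitions (2 + k) → i ≤ suc k →
  suc (Dfuel f (nPrime (+ suc n) (2 + k) λs i) (mult (2 + k ∸ i) λs)) ≤ Dfuel (suc f) (+ suc n) (2 + k)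
Dfuel-call {f} {n} {k} {λs} {i} λ∈ i≤1+k =
  s≤s (≤-maxList (∈-concatMap⁺ calls {xs = partitions (2 + k)} (lose λ∈ (∈-map⁺ (call-depth λs) (∈-range⁺ z≤n i≤1+k)))))
  where
  call-depth : List ℕ → ℕ → ℕ
  call-depth λs i = Dfuel f (nPrime (+ suc n) (2 + k) λs i) (mult (2 + k ∸ i) λs)
  calls : List ℕ → List ℕ
  calls λs = map (call-depth λs) (range 0 (suc k))

Dfuel-partition-step : ∀ {f n k λs i m n′} → λs ∈ partitions (2 + k) → i + m ≡ 2 + k → 1 ≤ m →
  (m * suc n + 2 * excess m λs) ⊖ (2 * i) ≡ + n′ →
  suc (Dfuel f (+ n′) (mult m λs)) ≤ Dfuel (suc f) (+ suc n) (2 + k)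
Dfuel-partition-step {f} {n} {k} {λs} {i} {m} λ∈ i+m≡k 1≤m n′≡ =
  subst₂ (λ x d → suc (Dfuel f x d) ≤ Dfuel (suc f) (+ suc n) (2 + k))
         (trans (nPrime-on-partition {suc n} {2 + k} {λs} {i} {m} λ∈ i+m≡k) n′≡) (cong (λ m → mult m λs) k∸i≡m)
         (Dfuel-call {f} {n} {k} {λs} {i} λ∈ i≤1+k)
  where
  k∸i≡m : 2 + k ∸ i ≡ m
  k∸i≡m = trans (cong (_∸ i) (sym i+m≡k)) (m+n∸m≡n i m)
  i≤1+k : i ≤ suc k
  i≤1+k = ≤-pred (subst (_≤ 2 + k) (+-comm i 1) (subst (i + 1 ≤_) i+m≡k (+-monoʳ-≤ i 1≤m)))

-- The partition 1^k with i = k - 1.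
Dfuel-ones-step : ∀ f n k → suc (Dfuel f (+ n) (2 + k)) ≤ Dfuel (suc f) (+ (2 * suc k + n)) (2 + k)
Dfuel-ones-step f n k =
  subst (λ d → suc (Dfuel f (+ n) d) ≤ Dfuel (suc f) (+ (2 * suc k + n)) (2 + k)) (mult-replicate (2 + k))
        (Dfuel-partition-step {f} {k + 1 * suc k + n} {k} {replicate (2 + k) 1} {suc k} {1} {n}
          (replicate-∈-partsGo (2 + k) {2 + k} (s≤s z≤n)) (+-comm (suc k) 1) ≤-refl n′≡)
  where
  n′≡ : (1 * (2 * suc k + n) + 2 * excess 1 (replicate (2 + k) 1)) ⊖ (2 * suc k) ≡ + n
  n′≡ = begin
    (1 * (2 * suc k + n) + 2 * excess 1 (replicate (2 + k) 1)) ⊖ (2 * suc k)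
      ≡⟨ cong (λ t → (1 * (2 * suc k + n) + 2 * t) ⊖ (2 * suc k)) (excess-replicate (2 + k)) ⟩
    (1 * (2 * suc k + n) + 2 * 0) ⊖ (2 * suc k)
      ≡⟨ cong (_⊖ (2 * suc k)) (regroup (2 * suc k + n)) ⟩
    (2 * suc k + n) ⊖ (2 * suc k)
      ≡⟨ ⊖-≥ (m≤m+n (2 * suc k) n) ⟩
    + (2 * suc k + n ∸ 2 * suc k)
      ≡⟨ cong +_ (m+n∸m≡n (2 * suc k) n) ⟩
    + n ∎
    where
    open ≡-Reasoning
    regroup : ∀ N → 1 * N + 2 * 0 ≡ N
    regroup = solve-∀

-- A partition with exactly two parts ⌊k/2⌋ and no larger part, with i = ⌈k/2⌉.
Dfuel-halving-step : ∀ {f n k λs} → λs ∈ partitions (2 + k) → mult ⌊ 2 + k /2⌋ λs ≡ 2 → excess ⌊ 2 + k /2⌋ λs ≡ 0 →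
  2 * ⌈ 2 + k /2⌉ ≤ ⌊ 2 + k /2⌋ * suc n →
  suc (Dfuel f (+ (⌊ 2 + k /2⌋ * suc n ∸ 2 * ⌈ 2 + k /2⌉)) 2) ≤ Dfuel (suc f) (+ suc n) (2 + k)
Dfuel-halving-step {f} {n} {k} {λs} λ∈ mult≡2 excess≡0 room =
  subst (λ d → suc (Dfuel f (+ X) d) ≤ Dfuel (suc f) (+ suc n) (2 + k)) mult≡2
        (Dfuel-partition-step {f} {n} {k} {λs} {c} {h} {X} λ∈ (trans (+-comm c h) (⌊n/2⌋+⌈n/2⌉≡n (2 + k))) (s≤s z≤n) n′≡)
  where
  h c X : ℕ
  h = ⌊ 2 + k /2⌋
  c = ⌈ 2 + k /2⌉
  X = h * suc n ∸ 2 * c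
  n′≡ : (h * suc n + 2 * excess h λs) ⊖ (2 * c) ≡ + X
  n′≡ = begin
    (h * suc n + 2 * excess h λs) ⊖ (2 * c)  ≡⟨ cong (λ t → (h * suc n + 2 * t) ⊖ (2 * c)) excess≡0 ⟩
    (h * suc n + 2 * 0) ⊖ (2 * c)            ≡⟨ cong (_⊖ (2 * c)) (+-identityʳ (h * suc n)) ⟩
    (h * suc n) ⊖ (2 * c)                    ≡⟨ ⊖-≥ room ⟩
    + X                                      ∎
    where open ≡-Reasoning

⌈n/2⌉≤Dfuel-2 : ∀ {n f} → n ≤ f → ⌈ n /2⌉ ≤ Dfuel f (+ n) 2
⌈n/2⌉≤Dfuel-2 {zero}                 _         = z≤n
⌈n/2⌉≤Dfuel-2 {suc zero}    {suc f}  _         = s≤s z≤n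
⌈n/2⌉≤Dfuel-2 {suc (suc n)} {suc f} (s≤s n≤f) =
  ≤-trans (s≤s (⌈n/2⌉≤Dfuel-2 (≤-trans (n≤1+n n) n≤f))) (Dfuel-ones-step f n 0)

[n+3]/4≤Dfuel-3 : ∀ {n f} → n ≤ f → (n + 3) / 4 ≤ Dfuel f (+ n) 3
[n+3]/4≤Dfuel-3 {zero}          _ = z≤n
[n+3]/4≤Dfuel-3 {1}     {suc f} _ = s≤s z≤n
[n+3]/4≤Dfuel-3 {2}     {suc f} _ = s≤s z≤n
[n+3]/4≤Dfuel-3 {3}     {suc f} _ = s≤s z≤n
[n+3]/4≤Dfuel-3 {4}     {suc f} _ = s≤s z≤n
[n+3]/4≤Dfuel-3 {suc (suc (suc (suc (suc n))))} {suc f} (s≤s n≤f) = begin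
  (4 + (suc n + 3)) / 4              ≡⟨ [4+n]/4≡1+n/4 (suc n + 3) ⟩
  suc ((suc n + 3) / 4)              ≤⟨ s≤s ([n+3]/4≤Dfuel-3 (≤-trans (m≤n+m (suc n) 3) n≤f)) ⟩
  suc (Dfuel f (+ suc n) 3)          ≤⟨ Dfuel-ones-step f (suc n) 1 ⟩
  Dfuel (suc f) (+ (5 + n)) 3        ∎
  where open ≤-Reasoning

depthIs-squeeze : ∀ {x k v w} F → (∀ f → Dfuel f x k ≤ v) → (∀ {f} → F ≤ f → v ≤ Dfuel f x k) → + v ≡ w → DepthIs x k w
depthIs-squeeze F upper lower v≡w = F , λ f F≤f → trans (cong +_ (≤-antisym (upper f) (lower F≤f))) v≡w

depthFormula : ℕ → ℕ → ℤ
depthFormula n k = (+ ⌈ ⌊ k /2⌋ * n /2⌉ - + ⌈ k /2⌉) +ℤ + 1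

depthFormula-2 : ∀ n → + ⌈ n /2⌉ ≡ depthFormula n 2
depthFormula-2 n = sym (trans (cancel (+ ⌈ 1 * n /2⌉) (+ 1)) (cong (λ m → + ⌈ m /2⌉) (*-identityˡ n)))
  where
  cancel : ∀ (x y : ℤ) → (x - y) +ℤ y ≡ x
  cancel = ℤ-Solver.solve-∀

depthFormula-large : ∀ {n k} → 2 * ⌈ k /2⌉ ≤ ⌊ k /2⌋ * n → + suc ⌈ ⌊ k /2⌋ * n ∸ 2 * ⌈ k /2⌉ /2⌉ ≡ depthFormula n k
depthFormula-large {n} {k} room = begin
  + suc x                     ≡⟨ cong +_ (+-comm 1 x) ⟩
  + (x + 1)                   ≡⟨ pos-+ x 1 ⟩
  + x +ℤ + 1                  ≡⟨ cong (_+ℤ + 1) (cancel (+ x) (+ c)) ⟨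
  (+ x +ℤ + c - + c) +ℤ + 1   ≡⟨ cong (λ z → (z - + c) +ℤ + 1) (pos-+ x c) ⟨
  (+ (x + c) - + c) +ℤ + 1    ≡⟨ cong (λ z → (+ z - + c) +ℤ + 1) (⌈m/2⌉≡⌈[m∸2n]/2⌉+n {n = c} room) ⟨
  depthFormula n k            ∎
  where
  open ≡-Reasoning
  c x : ℕ
  c = ⌈ k /2⌉
  x = ⌈ ⌊ k /2⌋ * n ∸ 2 * c /2⌉
  cancel : ∀ (x y : ℤ) → (x +ℤ y) - y ≡ x
  cancel = ℤ-Solver.solve-∀

depth-1 : ∀ n → DepthIs (+ n) 1 (depthFormula n 1)
depth-1 n = depthIs-squeeze 0 (λ f → subst (Dfuel f (+ n) 1 ≤_) (bound-1 n) (Dfuel≤depthBound f (+ n) 1)) (λ _ → z≤n) refl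
  where
  bound-1 : ∀ n → depthBound n 1 ≡ 0
  bound-1 zero    = refl
  bound-1 (suc n) = refl

depth-2 : ∀ n → DepthIs (+ n) 2 (depthFormula n 2)
depth-2 n = depthIs-squeeze n (λ f → subst (Dfuel f (+ n) 2 ≤_) (depthBound-2 n) (Dfuel≤depthBound f (+ n) 2))
                            ⌈n/2⌉≤Dfuel-2 (depthFormula-2 n)

depth-3 : ∀ n → DepthIs (+ n) 3 (+ ((n + 3) / 4))
depth-3 n = depthIs-squeeze n (λ f → subst (Dfuel f (+ n) 3 ≤_) (bound-3 n) (Dfuel≤depthBound f (+ n) 3))
                            [n+3]/4≤Dfuel-3 refl
  where
  bound-3 : ∀ n → depthBound n 3 ≡ (n + 3) / 4
  bound-3 zero    = refl
  bound-3 (suc n) = refl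

depth-large : ∀ {n k} → 4 ≤ k → 2 * ⌈ k /2⌉ ≤ ⌊ k /2⌋ * suc n → DepthIs (+ suc n) k (depthFormula (suc n) k)
depth-large {n} {k@(suc (suc (suc (suc k₀))))} 4≤k@(s≤s (s≤s (s≤s (s≤s _)))) room
  with λs , λ∈ , mult≡2 , excess≡0 ← halving-partition 4≤k =
  depthIs-squeeze (suc X) upper lower (depthFormula-large {suc n} {k} room)
  where
  X : ℕ
  X = ⌊ k /2⌋ * suc n ∸ 2 * ⌈ k /2⌉
  upper : ∀ f → Dfuel f (+ suc n) k ≤ suc ⌈ X /2⌉
  upper f = subst (Dfuel f (+ suc n) k ≤_) (generalBound-exact {suc n} {k} room) (Dfuel≤depthBound f (+ suc n) k)
  lower : ∀ {f} → suc X ≤ f → suc ⌈ X /2⌉ ≤ Dfuel f (+ suc n) k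
  lower {suc f} (s≤s X≤f) = ≤-trans (s≤s (⌈n/2⌉≤Dfuel-2 X≤f)) (Dfuel-halving-step {f} {n} {2 + k₀} λ∈ mult≡2 excess≡0 room)

even⇒2⌈k/2⌉≤⌊k/2⌋n : ∀ {n k} → 2 ∣ k → 2 ≤ n → 2 * ⌈ k /2⌉ ≤ ⌊ k /2⌋ * n
even⇒2⌈k/2⌉≤⌊k/2⌋n {n} {k} 2∣k 2≤n = begin
  2 * ⌈ k /2⌉   ≡⟨ cong (2 *_) (even⇒⌈n/2⌉≡⌊n/2⌋ 2∣k) ⟩
  2 * ⌊ k /2⌋   ≡⟨ *-comm 2 ⌊ k /2⌋ ⟩
  ⌊ k /2⌋ * 2   ≤⟨ *-monoʳ-≤ ⌊ k /2⌋ 2≤n ⟩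
  ⌊ k /2⌋ * n   ∎
  where open ≤-Reasoning

odd⇒2⌈k/2⌉≤⌊k/2⌋n : ∀ {n k} → ¬ 2 ∣ k → 5 ≤ k → 4 ≤ n → 2 * ⌈ k /2⌉ ≤ ⌊ k /2⌋ * n
odd⇒2⌈k/2⌉≤⌊k/2⌋n {n} {k} 2∤k 5≤k 4≤n = begin
  2 * ⌈ k /2⌉              ≡⟨ cong (2 *_) (odd⇒⌈n/2⌉≡1+⌊n/2⌋ 2∤k) ⟩
  2 * suc ⌊ k /2⌋          ≡⟨ regroup₁ ⌊ k /2⌋ ⟩
  2 * ⌊ k /2⌋ + 2 * 1      ≤⟨ +-monoʳ-≤ (2 * ⌊ k /2⌋) (*-monoʳ-≤ 2 (2m≤n⇒m≤⌊n/2⌋ {1} (≤-trans (s≤s (s≤s z≤n)) 5≤k))) ⟩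
  2 * ⌊ k /2⌋ + 2 * ⌊ k /2⌋ ≡⟨ regroup₂ ⌊ k /2⌋ ⟩
  ⌊ k /2⌋ * 4              ≤⟨ *-monoʳ-≤ ⌊ k /2⌋ 4≤n ⟩
  ⌊ k /2⌋ * n              ∎
  where
  open ≤-Reasoning
  regroup₁ : ∀ h → 2 * suc h ≡ 2 * h + 2 * 1
  regroup₁ = solve-∀
  regroup₂ : ∀ h → 2 * h + 2 * h ≡ h * 4
  regroup₂ = solve-∀

depth-formula : ∀ n k → (k ≡ 1 ⊎ k ≡ 2 ⊎ (2 ∣ k × 4 ≤ k × 2 ≤ n) ⊎ (¬ (2 ∣ k) × 5 ≤ k × 4 ≤ n)) →
                DepthIs (+ n) k (depthFormula n k)
depth-formula n _ (inj₁ refl)                                  = depth-1 n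
depth-formula n _ (inj₂ (inj₁ refl))                           = depth-2 n
depth-formula _ _ (inj₂ (inj₂ (inj₁ (2∣k , 4≤k , 2≤n@(s≤s _))))) = depth-large 4≤k (even⇒2⌈k/2⌉≤⌊k/2⌋n 2∣k 2≤n)
depth-formula _ _ (inj₂ (inj₂ (inj₂ (2∤k , 5≤k , 4≤n@(s≤s _))))) = depth-large (≤-trans (n≤1+n 4) 5≤k) (odd⇒2⌈k/2⌉≤⌊k/2⌋n 2∤k 5≤k 4≤n)

lemma4p1 : (∀ (n k : ℕ) → 1 ≤ k →
               (k ≡ 1 ⊎ k ≡ 2 ⊎ (2 ∣ k × 4 ≤ k × 2 ≤ n) ⊎ (¬ (2 ∣ k) × 5 ≤ k × 4 ≤ n)) →
               DepthIs (+ n) k ((+ ⌈ (⌊ k /2⌋ * n) /2⌉ - + ⌈ k /2⌉) +ℤ + 1))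
             × (∀ (n : ℕ) → DepthIs (+ n) 3 (+ ((n Data.Nat.+ 3) / 4)))
lemma4p1 = (λ n k _ → depth-formula n k) , depth-3
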